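{- For every oriented graph $D$, $\operatorname{inv}(D) \leq \tau'(D)$ and $\operatorname{inv}(D) \leq 2\tau(D)$.
   Context: An oriented graph is a digraph with no loops, no multiple arcs and no directed cycle of length 2. For a digraph $D$ and $X\subseteq V(D)$, inverting $X$ means reversing the direction of every arc with both ends in $X$. A decycling family of an oriented graph $D$ is a finite family of subsets of $V(D)$ such that inverting them one after another yields an acyclic digraph; the inversion number $\operatorname{inv}(D)$ is the minimum size of a decycling family (the empty digraph has inversion number $0$). $\tau(D)$ (cycle transversal number) is the minimum number of vertices whose deletion makes $D$ acyclic, and $\tau'(D)$ (cycle arc-transversal number) is the minimum number of arcs whose deletion makes $D$ acyclic. -}

module Defs where

open import Data.Nat using (ℕ; suc)
open import Data.Bool using (Bool; true; false; _∧_; _∨_; not; T)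
open import Data.Fin using (Fin; _≟_)
open import Data.Fin.Subset using (Subset; _∈_; _∉_; ∣_∣)
open import Data.Vec using (lookup)
open import Data.Product using (_×_; _,_; ∃-syntax)
open import Data.List using (List; []; _∷_; foldl; length)
open import Data.Bool.ListAction using (any)
open import Relation.Nullary using (¬_)
open import Relation.Nullary.Decidable using (⌊_⌋)

-- A digraph on the vertex set Fin n, given by its (decidable) arc relation:
-- there is an arc u → v iff  T (arc u v).  (No multiple arcs by construction.)
record Digraph (n : ℕ) : Set where
  constructor mkDigraph
  field
    arc : Fin n → Fin n → Bool
open Digraph public

IsOriented : ∀ {n} → Digraph n → Set
IsOriented D = (∀ u → ¬ T (arc D u u)) × (∀ u v → T (arc D u v) → ¬ T (arc D v u))

data Walk {n : ℕ} (D : Digraph n) : Fin n → Fin n → Set where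
  edge : ∀ {x y} → T (arc D x y) → Walk D x y
  step : ∀ {x y z} → T (arc D x y) → Walk D y z → Walk D x z

Acyclic : ∀ {n} → Digraph n → Set
Acyclic D = ∀ x → ¬ Walk D x x

mem : ∀ {n} → Subset n → Fin n → Bool
mem X i = lookup X i

invert : ∀ {n} → Digraph n → Subset n → Digraph n
invert D X = mkDigraph λ u v →
  let both = mem X u ∧ mem X v in
  (arc D u v ∧ not both) ∨ (arc D v u ∧ both)

invertAll : ∀ {n} → Digraph n → List (Subset n) → Digraph n
invertAll D F = foldl invert D F

IsDecycling : ∀ {n} → Digraph n → List (Subset n) → Set
IsDecycling D F = Acyclic (invertAll D F)

-- Deleting a set S of vertices (deleted vertices become isolated, which does not
-- affect acyclicity of the remaining induced subdigraph).
deleteVertices : ∀ {n} → Digraph n → Subset n → Digraph n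
deleteVertices D S = mkDigraph λ u v → arc D u v ∧ not (mem S u) ∧ not (mem S v)

eqArc : ∀ {n} → Fin n × Fin n → Fin n × Fin n → Bool
eqArc (a , b) (c , d) = ⌊ a ≟ c ⌋ ∧ ⌊ b ≟ d ⌋

deleteArcs : ∀ {n} → Digraph n → List (Fin n × Fin n) → Digraph n
deleteArcs D L = mkDigraph λ u v → arc D u v ∧ not (any (eqArc (u , v)) L)

InvAtMost : ∀ {n} → Digraph n → ℕ → Set
InvAtMost D k = ∃[ F ] (IsDecycling D F × length F Data.Nat.≤ k)

-- Inverting a family of vertex sets acts on each pair {x, y} separately: the
-- arcs between x and y are reversed iff an odd number of the sets contain both.
--
-- inv ≤ τ′: delete one arc uv of the transversal, decycle the rest by induction
-- and apply the same family to D. The result differs from an acyclic digraph G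
-- only by one arc between u and v; in G one of u, v cannot reach the other, so
-- either that arc already points the safe way or inverting {u, v} turns it.
--
-- inv ≤ 2τ: delete one vertex v of the transversal and decycle the rest by
-- induction. Applying the same family to D, then inverting ⁅v⁆ ∪ N⁺(v) and
-- N⁺(v), reverses exactly the arcs leaving v (arcs inside N⁺(v) are inverted
-- twice), so v becomes a sink and no cycle can pass through it.
module Submission where

open import Defs
open import Data.Nat using (ℕ; suc; _+_; _*_; _≤_; z≤n)
open import Data.Nat.Properties
  using (+-comm; +-monoʳ-≤; *-monoʳ-≤; *-suc; m≤n⇒m≤1+n; ≤-reflexive; ≤-trans; module ≤-Reasoning)
open import Data.Bool using (Bool; true; false; _∧_; _∨_; not; T; if_then_else_; _xor_)
open import Data.Bool.Properties
  using (T-∧; T-∨; T-not-≡; ∧-comm; ∧-identityʳ; xor-same; xor-identityʳ)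
open import Data.Fin using (Fin; _≟_)
open import Data.Fin.Subset using (Subset; _∈_; _∉_; _∪_; _-_; ⁅_⁆; _⊂_; ∣_∣)
open import Data.Fin.Subset.Properties
  using (x∈⁅x⁆; x∈⁅y⁆⇒x≡y; x≢y⇒x∉⁅y⁆; x∈p∪q⁺; x∈p∪q⁻; x∈p∩q⁺; x∈p∧x≢y⇒x∈p-y;
         p∩q≢∅⇒p─q⊂p; p⊂q⇒∣p∣<∣q∣; nonempty?)
open import Data.Fin.Subset.Induction using (⊂-wellFounded)
open import Data.List using (List; []; _∷_; _++_; length; allFin)
open import Data.List.Properties using (foldl-++; length-++)
open import Data.List.Membership.Propositional using () renaming (_∈_ to _∈ˡ_)
open import Data.List.Membership.Propositional.Properties using (∈-allFin)
open import Data.List.Relation.Unary.Any using (here; there)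
open import Data.Bool.ListAction using (any)
open import Data.Vec using (lookup; tabulate)
open import Data.Vec.Properties using (lookup∘tabulate; lookup-zipWith; []=⇒lookup; lookup⇒[]=)
open import Data.Product using (_×_; _,_; proj₁; proj₂; swap)
open import Data.Sum using (_⊎_; inj₁; inj₂; [_,_]′)
open import Data.Empty using (⊥-elim)
open import Data.Unit using (tt)
open import Function using (_∘_; id)
open import Function.Bundles using (Equivalence; _⇔_; mk⇔)
open import Induction.WellFounded using (Acc; acc)
open import Relation.Nullary using (¬_; Dec; yes; no)
open import Relation.Nullary.Decidable using (map′; T?; _×-dec_)
open import Relation.Binary.PropositionalEquality
  using (_≡_; refl; sym; trans; cong; cong₂; subst; module ≡-Reasoning)

open Equivalence using (to; from)

private
  variable
    n k : ℕ
    D E G H K : Digraph n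
    a b u v x y z : Fin n
    p : Subset n

¬T⇒≡false : ∀ {c} → ¬ T c → c ≡ false
¬T⇒≡false {false} _ = refl
¬T⇒≡false {true} ¬t = ⊥-elim (¬t tt)

¬T-if : ∀ {c d} → (T c → ¬ T d) → ¬ T (if c then d else c)
¬T-if {true} ¬cd t = ¬cd tt t

if-xor : ∀ {A : Set} c f (s t : A) →
         (if f then (if c then s else t) else (if c then t else s)) ≡ (if c xor f then t else s)
if-xor true true s t = refl
if-xor true false s t = refl
if-xor false true s t = refl
if-xor false false s t = refl

if-same : ∀ {A : Set} c (s : A) → (if c then s else s) ≡ s
if-same true s = refl
if-same false s = refl

mem-∈ : x ∈ p → mem p x ≡ true
mem-∈ = []=⇒lookup

mem-∉ : x ∉ p → mem p x ≡ false
mem-∉ {x = x} {p = p} x∉p with mem p x in eq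
... | true = ⊥-elim (x∉p (lookup⇒[]= x p eq))
... | false = refl

T-not-mem⇔∉ : T (not (mem p x)) ⇔ (x ∉ p)
T-not-mem⇔∉ = mk⇔ (λ t x∈p → subst (T ∘ not) (mem-∈ x∈p) t) (from T-not-≡ ∘ mem-∉)

mem-∪ : ∀ (p q : Subset n) x → mem (p ∪ q) x ≡ mem p x ∨ mem q x
mem-∪ p q x = lookup-zipWith _∨_ x p q

_⊆ᴰ_ : Digraph n → Digraph n → Set
D ⊆ᴰ E = ∀ {x y} → T (arc D x y) → T (arc E x y)

walk-mono : D ⊆ᴰ E → Walk D x y → Walk E x y
walk-mono D⊆E (edge t) = edge (D⊆E t)
walk-mono D⊆E (step t w) = step (D⊆E t) (walk-mono D⊆E w)

acyclic-mono : D ⊆ᴰ E → Acyclic E → Acyclic D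
acyclic-mono D⊆E acE x = acE x ∘ walk-mono D⊆E

oriented-mono : D ⊆ᴰ E → IsOriented E → IsOriented D
oriented-mono D⊆E (noLoop , noDigon) =
  (λ x → noLoop x ∘ D⊆E) , λ x y t s → noDigon x y (D⊆E t) (D⊆E s)

_++ʷ_ : Walk G x y → Walk G y z → Walk G x z
edge t ++ʷ w = step t w
step t w ++ʷ w′ = step t (w ++ʷ w′)

Reach : Digraph n → Fin n → Fin n → Set
Reach G x y = x ≡ y ⊎ Walk G x y

reach-trans : Reach G x y → Reach G y z → Reach G x z
reach-trans (inj₁ refl) r = r
reach-trans (inj₂ w) (inj₁ refl) = inj₂ w
reach-trans (inj₂ w) (inj₂ w′) = inj₂ (w ++ʷ w′)

walk-+arc : (∀ {x y} → T (arc K x y) → T (arc G x y) ⊎ (x ≡ a × y ≡ b)) →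
            Walk K x y → Walk G x y ⊎ (Reach G x a × Reach G b y)
walk-+arc K⊆G+ab (edge t) with K⊆G+ab t
... | inj₁ g = inj₁ (edge g)
... | inj₂ (refl , refl) = inj₂ (inj₁ refl , inj₁ refl)
walk-+arc K⊆G+ab (step t w) with K⊆G+ab t | walk-+arc K⊆G+ab w
... | inj₁ g | inj₁ w′ = inj₁ (step g w′)
... | inj₁ g | inj₂ (xa , by) = inj₂ (reach-trans (inj₂ (edge g)) xa , by)
... | inj₂ (refl , refl) | inj₁ w′ = inj₂ (inj₁ refl , inj₂ w′)
... | inj₂ (refl , refl) | inj₂ (_ , by) = inj₂ (inj₁ refl , by)

acyclic-+arc : Acyclic G → ¬ a ≡ b → ¬ Walk G b a →
               (∀ {x y} → T (arc K x y) → T (arc G x y) ⊎ (x ≡ a × y ≡ b)) → Acyclic K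
acyclic-+arc acG a≢b ¬ba K⊆G+ab x c with walk-+arc K⊆G+ab c
... | inj₁ c′ = acG x c′
... | inj₂ (xa , bx) with reach-trans bx xa
...   | inj₁ b≡a = a≢b (sym b≡a)
...   | inj₂ ba = ¬ba ba

Sink : Digraph n → Fin n → Set
Sink K v = ∀ {y} → ¬ T (arc K v y)

sink-¬walk : Sink K v → ¬ Walk K v y
sink-¬walk sink (edge t) = sink t
sink-¬walk sink (step t _) = sink t

walk-+sink : Sink K v → (∀ {x y} → T (arc K x y) → T (arc G x y) ⊎ y ≡ v) →
             Walk K x y → Walk G x y ⊎ y ≡ v
walk-+sink sink K⊆G+v (edge t) = [ inj₁ ∘ edge , inj₂ ]′ (K⊆G+v t)
walk-+sink sink K⊆G+v (step t w) with K⊆G+v t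
... | inj₂ refl = ⊥-elim (sink-¬walk sink w)
... | inj₁ g = [ inj₁ ∘ step g , inj₂ ]′ (walk-+sink sink K⊆G+v w)

acyclic-+sink : Acyclic G → Sink K v → (∀ {x y} → T (arc K x y) → T (arc G x y) ⊎ y ≡ v) → Acyclic K
acyclic-+sink acG sink K⊆G+v x c with walk-+sink sink K⊆G+v c
... | inj₁ c′ = acG x c′
... | inj₂ refl = sink-¬walk sink c

-- Floyd–Warshall: T (walkVia G S x y) iff some walk from x to y has all its
-- interior vertices in S.
walkVia : Digraph n → List (Fin n) → Fin n → Fin n → Bool
walkVia G [] x y = arc G x y
walkVia G (w ∷ S) x y = walkVia G S x y ∨ (walkVia G S x w ∧ walkVia G S w y)

module _ {G : Digraph n} where

  walkVia-sound : ∀ S → T (walkVia G S x y) → Walk G x y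
  walkVia-sound [] t = edge t
  walkVia-sound (w ∷ S) t with to T-∨ t
  ... | inj₁ xy = walkVia-sound S xy
  ... | inj₂ xwy = walkVia-sound S (proj₁ (to T-∧ xwy)) ++ʷ walkVia-sound S (proj₂ (to T-∧ xwy))

  walkVia-arc : ∀ S → T (arc G x y) → T (walkVia G S x y)
  walkVia-arc [] t = t
  walkVia-arc (w ∷ S) t = from T-∨ (inj₁ (walkVia-arc S t))

  private
    through : ∀ w S → T (walkVia G S x w) → T (walkVia G S w y) → T (walkVia G (w ∷ S) x y)
    through w S xw wy = from T-∨ (inj₂ (from T-∧ (xw , wy)))

    into : ∀ w S → T (walkVia G (w ∷ S) x w) → T (walkVia G S x w)
    into w S = [ id , proj₁ ∘ to T-∧ ]′ ∘ to T-∨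

    out-of : ∀ w S → T (walkVia G (w ∷ S) w y) → T (walkVia G S w y)
    out-of w S = [ id , proj₂ ∘ to T-∧ ]′ ∘ to T-∨

  walkVia-trans : ∀ S → z ∈ˡ S → T (walkVia G S x z) → T (walkVia G S z y) → T (walkVia G S x y)
  walkVia-trans (w ∷ S) (here refl) xz zy = through w S (into w S xz) (out-of w S zy)
  walkVia-trans (w ∷ S) (there z∈S) xz zy with to T-∨ xz | to T-∨ zy
  ... | inj₁ xz′ | inj₁ zy′ = from T-∨ (inj₁ (walkVia-trans S z∈S xz′ zy′))
  ... | inj₁ xz′ | inj₂ zwy =
    through w S (walkVia-trans S z∈S xz′ (proj₁ (to T-∧ zwy))) (proj₂ (to T-∧ zwy))
  ... | inj₂ xwz | inj₁ zy′ =
    through w S (proj₁ (to T-∧ xwz)) (walkVia-trans S z∈S (proj₂ (to T-∧ xwz)) zy′)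
  ... | inj₂ xwz | inj₂ zwy = through w S (proj₁ (to T-∧ xwz)) (proj₂ (to T-∧ zwy))

  walkVia-complete : Walk G x y → T (walkVia G (allFin n) x y)
  walkVia-complete (edge t) = walkVia-arc (allFin n) t
  walkVia-complete (step t w) =
    walkVia-trans (allFin n) (∈-allFin _) (walkVia-arc (allFin n) t) (walkVia-complete w)

walk? : ∀ (G : Digraph n) x y → Dec (Walk G x y)
walk? G x y = map′ (walkVia-sound (allFin _)) walkVia-complete (T? (walkVia G (allFin _) x y))

acyclic-one-way : Acyclic G → ∀ a b → ¬ Walk G a b ⊎ ¬ Walk G b a
acyclic-one-way {G = G} acG a b with walk? G a b
... | no ¬ab = inj₁ ¬ab
... | yes ab = inj₂ λ ba → acG a (ab ++ʷ ba)

flipped : List (Subset n) → Fin n → Fin n → Bool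
flipped [] x y = false
flipped (X ∷ F) x y = (mem X x ∧ mem X y) xor flipped F x y

flipped-sym : ∀ (F : List (Subset n)) x y → flipped F x y ≡ flipped F y x
flipped-sym [] x y = refl
flipped-sym (X ∷ F) x y = cong₂ _xor_ (∧-comm (mem X x) (mem X y)) (flipped-sym F x y)

arc-invert : ∀ (D : Digraph n) X x y →
             arc (invert D X) x y ≡ (if mem X x ∧ mem X y then arc D y x else arc D x y)
arc-invert D X x y = select (mem X x ∧ mem X y) (arc D x y) (arc D y x)
  where
  select : ∀ c s t → (s ∧ not c) ∨ (t ∧ c) ≡ (if c then t else s)
  select true true t = ∧-identityʳ t
  select true false t = ∧-identityʳ t
  select false true t = refl
  select false false t = ∧-comm t false

arc-invertAll : ∀ (D : Digraph n) F x y →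
                arc (invertAll D F) x y ≡ (if flipped F x y then arc D y x else arc D x y)
arc-invertAll D [] x y = refl
arc-invertAll D (X ∷ F) x y = begin
  arc (invertAll (invert D X) F) x y
    ≡⟨ arc-invertAll (invert D X) F x y ⟩
  (if f then arc (invert D X) y x else arc (invert D X) x y)
    ≡⟨ cong₂ (if f then_else_) (arc-invert D X y x) (arc-invert D X x y) ⟩
  (if f then (if mem X y ∧ mem X x then arc D x y else arc D y x)
        else (if mem X x ∧ mem X y then arc D y x else arc D x y))
    ≡⟨ cong (λ c → if f then (if c then arc D x y else arc D y x)
                                  else (if mem X x ∧ mem X y then arc D y x else arc D x y))
         (∧-comm (mem X y) (mem X x)) ⟩
  (if f then (if mem X x ∧ mem X y then arc D x y else arc D y x)
        else (if mem X x ∧ mem X y then arc D y x else arc D x y))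
    ≡⟨ if-xor (mem X x ∧ mem X y) f (arc D x y) (arc D y x) ⟩
  (if (mem X x ∧ mem X y) xor f then arc D y x else arc D x y) ∎
  where
  open ≡-Reasoning
  f = flipped F x y

module _ (F : List (Subset n)) where

  invertAll-loop : ∀ (D : Digraph n) x → arc (invertAll D F) x x ≡ arc D x x
  invertAll-loop D x = trans (arc-invertAll D F x x) (if-same (flipped F x x) (arc D x x))

  invertAll-cong : ∀ (D E : Digraph n) → arc D x y ≡ arc E x y → arc D y x ≡ arc E y x →
                   arc (invertAll D F) x y ≡ arc (invertAll E F) x y
  invertAll-cong {x = x} {y = y} D E xy yx = begin
    arc (invertAll D F) x y                              ≡⟨ arc-invertAll D F x y ⟩
    (if flipped F x y then arc D y x else arc D x y)     ≡⟨ cong₂ (if flipped F x y then_else_) yx xy ⟩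
    (if flipped F x y then arc E y x else arc E x y)     ≡⟨ arc-invertAll E F x y ⟨
    arc (invertAll E F) x y                              ∎
    where open ≡-Reasoning

  invertAll-mono : D ⊆ᴰ E → invertAll D F ⊆ᴰ invertAll E F
  invertAll-mono {D = D} {E = E} D⊆E {x} {y} t =
    subst T (sym (arc-invertAll E F x y)) (lift (flipped F x y) (subst T (arc-invertAll D F x y) t))
    where
    lift : ∀ c → T (if c then arc D y x else arc D x y) → T (if c then arc E y x else arc E x y)
    lift true = D⊆E
    lift false = D⊆E

  invertAll-oriented : IsOriented D → IsOriented (invertAll D F)
  invertAll-oriented {D = D} (noLoop , noDigon) =
    (λ x → noLoop x ∘ subst T (invertAll-loop D x)) ,
    λ x y xy yx → noDigon′ (flipped F x y) (subst T (arc-invertAll D F x y) xy) (subst T (yx-closed x y) yx)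
    where
    yx-closed : ∀ x y → arc (invertAll D F) y x ≡ (if flipped F x y then arc D x y else arc D y x)
    yx-closed x y = trans (arc-invertAll D F y x)
                          (cong (if_then arc D x y else arc D y x) (flipped-sym F y x))

    noDigon′ : ∀ {x y} c → T (if c then arc D y x else arc D x y) → ¬ T (if c then arc D x y else arc D y x)
    noDigon′ true = noDigon _ _
    noDigon′ false = noDigon _ _

AgreeOff : Fin n → Fin n → Digraph n → Digraph n → Set
AgreeOff a b H G = ∀ x y → ¬ (x ≡ a × y ≡ b) → ¬ (x ≡ b × y ≡ a) → arc H x y ≡ arc G x y

agreeOff-sym : AgreeOff a b H G → AgreeOff b a H G
agreeOff-sym H≈G x y ¬ba ¬ab = H≈G x y ¬ab ¬ba

agreeOff-trans : AgreeOff a b K H → AgreeOff a b H G → AgreeOff a b K G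
agreeOff-trans K≈H H≈G x y ¬ab ¬ba = trans (K≈H x y ¬ab ¬ba) (H≈G x y ¬ab ¬ba)

agreeOff-⊆+arc : AgreeOff a b K G → ¬ T (arc K b a) →
                 ∀ {x y} → T (arc K x y) → T (arc G x y) ⊎ (x ≡ a × y ≡ b)
agreeOff-⊆+arc {a = a} {b = b} K≈G ¬Kba {x} {y} t with (x ≟ a) ×-dec (y ≟ b) | (x ≟ b) ×-dec (y ≟ a)
... | yes xy≡ab | _ = inj₂ xy≡ab
... | no _ | yes (refl , refl) = ⊥-elim (¬Kba t)
... | no ¬ab | no ¬ba = inj₁ (subst T (K≈G x y ¬ab ¬ba) t)

invert-inside : ∀ (H : Digraph n) {X} → x ∈ X → y ∈ X → arc (invert H X) x y ≡ arc H y x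
invert-inside {x = x} {y = y} H {X} x∈X y∈X =
  trans (arc-invert H X x y)
        (cong (if_then arc H y x else arc H x y) (cong₂ _∧_ (mem-∈ x∈X) (mem-∈ y∈X)))

mem-pair : ∀ (a b : Fin n) {x} → mem (⁅ a ⁆ ∪ ⁅ b ⁆) x ≡ true → x ≡ a ⊎ x ≡ b
mem-pair a b {x} x∈ with x∈p∪q⁻ ⁅ a ⁆ ⁅ b ⁆ (lookup⇒[]= x _ x∈)
... | inj₁ x∈a = inj₁ (x∈⁅y⁆⇒x≡y a x∈a)
... | inj₂ x∈b = inj₂ (x∈⁅y⁆⇒x≡y b x∈b)

invertPair-agreeOff : ∀ (H : Digraph n) → AgreeOff a b (invert H (⁅ a ⁆ ∪ ⁅ b ⁆)) H
invertPair-agreeOff {a = a} {b = b} H x y ¬ab ¬ba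
  rewrite arc-invert H (⁅ a ⁆ ∪ ⁅ b ⁆) x y
  with mem (⁅ a ⁆ ∪ ⁅ b ⁆) x in x∈ | mem (⁅ a ⁆ ∪ ⁅ b ⁆) y in y∈
... | false | _ = refl
... | true | false = refl
... | true | true with mem-pair a b x∈ | mem-pair a b y∈
...   | inj₁ refl | inj₁ refl = refl
...   | inj₁ refl | inj₂ refl = ⊥-elim (¬ab (refl , refl))
...   | inj₂ refl | inj₁ refl = ⊥-elim (¬ba (refl , refl))
...   | inj₂ refl | inj₂ refl = refl

acyclic-or-invert : ∀ {X} → Acyclic G → ¬ a ≡ b → ¬ Walk G b a → IsOriented H →
                    AgreeOff a b H G → AgreeOff a b (invert H X) H → a ∈ X → b ∈ X →
                    Acyclic H ⊎ Acyclic (invert H X)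
acyclic-or-invert {a = a} {b = b} {H = H} acG a≢b ¬ba oH H≈G K≈H a∈X b∈X with T? (arc H b a)
... | no ¬Hba = inj₁ (acyclic-+arc acG a≢b ¬ba (agreeOff-⊆+arc H≈G ¬Hba))
... | yes Hba = inj₂ (acyclic-+arc acG a≢b ¬ba (agreeOff-⊆+arc (agreeOff-trans K≈H H≈G) ¬Kba))
  where
  ¬Kba = proj₂ oH b a Hba ∘ subst T (invert-inside H b∈X a∈X)

acyclic-or-invertPair : Acyclic G → ¬ a ≡ b → IsOriented H → AgreeOff a b H G →
                        Acyclic H ⊎ Acyclic (invert H (⁅ a ⁆ ∪ ⁅ b ⁆))
acyclic-or-invertPair {a = a} {b = b} {H = H} acG a≢b oH H≈G =
  [ (λ ¬ab → acyclic-or-invert acG (a≢b ∘ sym) ¬ab oH (agreeOff-sym H≈G) (agreeOff-sym K≈H) b∈X a∈X)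
  , (λ ¬ba → acyclic-or-invert acG a≢b ¬ba oH H≈G K≈H a∈X b∈X)
  ]′ (acyclic-one-way acG a b)
  where
  K≈H = invertPair-agreeOff H
  a∈X = x∈p∪q⁺ (inj₁ (x∈⁅x⁆ a))
  b∈X = x∈p∪q⁺ (inj₂ (x∈⁅x⁆ b))

outNeighbours : Digraph n → Fin n → Subset n
outNeighbours H v = tabulate (arc H v)

sinkFamily : Digraph n → Fin n → List (Subset n)
sinkFamily H v = ⁅ v ⁆ ∪ outNeighbours H v ∷ outNeighbours H v ∷ []

module _ (H : Digraph n) (v : Fin n) where
  private
    N = outNeighbours H v

    mem-N : ∀ y → mem N y ≡ arc H v y
    mem-N = lookup∘tabulate (arc H v)

    mem-⁅v⁆∪N : ¬ y ≡ v → mem (⁅ v ⁆ ∪ N) y ≡ mem N y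
    mem-⁅v⁆∪N {y = y} y≢v = trans (mem-∪ ⁅ v ⁆ N y) (cong (_∨ mem N y) (mem-∉ (x≢y⇒x∉⁅y⁆ y≢v)))

  flipped-sinkFamily-away : ¬ x ≡ v → ¬ y ≡ v → flipped (sinkFamily H v) x y ≡ false
  flipped-sinkFamily-away {x = x} {y = y} x≢v y≢v = begin
    (mem (⁅ v ⁆ ∪ N) x ∧ mem (⁅ v ⁆ ∪ N) y) xor ((mem N x ∧ mem N y) xor false)
      ≡⟨ cong₂ (λ s t → (s ∧ t) xor ((mem N x ∧ mem N y) xor false))
               (mem-⁅v⁆∪N x≢v) (mem-⁅v⁆∪N y≢v) ⟩
    (mem N x ∧ mem N y) xor ((mem N x ∧ mem N y) xor false)
      ≡⟨ cong ((mem N x ∧ mem N y) xor_) (xor-identityʳ _) ⟩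
    (mem N x ∧ mem N y) xor (mem N x ∧ mem N y)
      ≡⟨ xor-same (mem N x ∧ mem N y) ⟩
    false ∎
    where open ≡-Reasoning

  flipped-sinkFamily-source : ¬ T (arc H v v) → ¬ y ≡ v → flipped (sinkFamily H v) v y ≡ arc H v y
  flipped-sinkFamily-source {y = y} ¬loop y≢v = begin
    (mem (⁅ v ⁆ ∪ N) v ∧ mem (⁅ v ⁆ ∪ N) y) xor ((mem N v ∧ mem N y) xor false)
      ≡⟨ cong₂ (λ s t → (s ∧ t) xor ((mem N v ∧ mem N y) xor false))
               (mem-∈ (x∈p∪q⁺ (inj₁ (x∈⁅x⁆ v)))) (mem-⁅v⁆∪N y≢v) ⟩
    mem N y xor ((mem N v ∧ mem N y) xor false)
      ≡⟨ cong (λ s → mem N y xor ((s ∧ mem N y) xor false)) (trans (mem-N v) (¬T⇒≡false ¬loop)) ⟩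
    mem N y xor false
      ≡⟨ xor-identityʳ _ ⟩
    mem N y
      ≡⟨ mem-N y ⟩
    arc H v y ∎
    where open ≡-Reasoning

  sinkFamily-away : ¬ x ≡ v → ¬ y ≡ v → arc (invertAll H (sinkFamily H v)) x y ≡ arc H x y
  sinkFamily-away {x = x} {y = y} x≢v y≢v =
    trans (arc-invertAll H (sinkFamily H v) x y)
          (cong (if_then arc H y x else arc H x y) (flipped-sinkFamily-away x≢v y≢v))

  sinkFamily-sink : IsOriented H → Sink (invertAll H (sinkFamily H v)) v
  sinkFamily-sink (noLoop , noDigon) {y} t with y ≟ v
  ... | yes refl = noLoop v (subst T (invertAll-loop (sinkFamily H v) H v) t)
  ... | no y≢v = ¬T-if (noDigon v y) (subst T reversed t)
    where
    reversed : arc (invertAll H (sinkFamily H v)) v y ≡ (if arc H v y then arc H y v else arc H v y)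
    reversed = trans (arc-invertAll H (sinkFamily H v) v y)
                     (cong (if_then arc H y v else arc H v y) (flipped-sinkFamily-source (noLoop v) y≢v))

acyclic⇒InvAtMost : Acyclic D → InvAtMost D k
acyclic⇒InvAtMost ac = [] , ac , z≤n

InvAtMost-mono : ∀ {m} → k ≤ m → InvAtMost D k → InvAtMost D m
InvAtMost-mono k≤m (F , ac , |F|≤k) = F , ac , ≤-trans |F|≤k k≤m

InvAtMost-++ : ∀ F F′ → length F ≤ k → Acyclic (invertAll (invertAll D F) F′) → InvAtMost D (length F′ + k)
InvAtMost-++ {k = k} {D = D} F F′ |F|≤k ac =
  F ++ F′ , subst Acyclic (sym (foldl-++ invert D F F′)) ac , |F++F′|≤
  where
  open ≤-Reasoning
  |F++F′|≤ : length (F ++ F′) ≤ length F′ + k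
  |F++F′|≤ = begin
    length (F ++ F′)       ≡⟨ length-++ F ⟩
    length F + length F′   ≡⟨ +-comm (length F) (length F′) ⟩
    length F′ + length F   ≤⟨ +-monoʳ-≤ (length F′) |F|≤k ⟩
    length F′ + k          ∎

deleteArcs-⊆ : ∀ {L} → deleteArcs D L ⊆ᴰ D
deleteArcs-⊆ = proj₁ ∘ to T-∧

deleteArcs-[] : D ⊆ᴰ deleteArcs D []
deleteArcs-[] t = from T-∧ (t , tt)

deleteArcs-∷ : ∀ {e L} → deleteArcs (deleteArcs D (e ∷ [])) L ⊆ᴰ deleteArcs D (e ∷ L)
deleteArcs-∷ {D = D} {e} {L} {x} {y} = restore (arc D x y) (eqArc (x , y) e) (any (eqArc (x , y)) L)
  where
  restore : ∀ d c r → T ((d ∧ not (c ∨ false)) ∧ not r) → T (d ∧ not (c ∨ r))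
  restore true false r t = t

deleteArc-off : ∀ (D : Digraph n) → ¬ (x ≡ u × y ≡ v) → arc (deleteArcs D ((u , v) ∷ [])) x y ≡ arc D x y
deleteArc-off {x = x} {u = u} {y = y} {v = v} D off with x ≟ u | y ≟ v
... | yes refl | yes refl = ⊥-elim (off (refl , refl))
... | yes _ | no _ = ∧-identityʳ (arc D x y)
... | no _ | _ = ∧-identityʳ (arc D x y)

InvAtMost-restoreArc : IsOriented D → InvAtMost (deleteArcs D ((u , v) ∷ [])) k → InvAtMost D (suc k)
InvAtMost-restoreArc {D = D} {u = u} {v = v} oD (F , acG , |F|≤k) with T? (arc D u v)
... | no ¬uv = F , acyclic-mono (invertAll-mono F D⊆E) acG , m≤n⇒m≤1+n |F|≤k
  where
  D⊆E : D ⊆ᴰ deleteArcs D ((u , v) ∷ [])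
  D⊆E {x} {y} t with (x ≟ u) ×-dec (y ≟ v)
  ... | yes (refl , refl) = ⊥-elim (¬uv t)
  ... | no off = subst T (sym (deleteArc-off D off)) t
... | yes uv = [ (λ acH → F , acH , m≤n⇒m≤1+n |F|≤k) , InvAtMost-++ F (⁅ u ⁆ ∪ ⁅ v ⁆ ∷ []) |F|≤k ]′
                 (acyclic-or-invertPair acG u≢v (invertAll-oriented F oD) H≈G)
  where
  u≢v : ¬ u ≡ v
  u≢v refl = proj₁ oD u uv
  D′ = deleteArcs D ((u , v) ∷ [])
  H≈G : AgreeOff u v (invertAll D F) (invertAll D′ F)
  H≈G x y ¬uv ¬vu =
    invertAll-cong F D D′ (sym (deleteArc-off D ¬uv)) (sym (deleteArc-off D (¬vu ∘ swap)))

InvAtMost-deleteArcs : ∀ L → IsOriented D → Acyclic (deleteArcs D L) → InvAtMost D (length L)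
InvAtMost-deleteArcs {D = D} [] oD ac = acyclic⇒InvAtMost (acyclic-mono (deleteArcs-[] {D = D}) ac)
InvAtMost-deleteArcs {D = D} (e ∷ L) oD ac =
  InvAtMost-restoreArc oD
    (InvAtMost-deleteArcs L (oriented-mono (deleteArcs-⊆ {D = D} {e ∷ []}) oD)
                            (acyclic-mono (deleteArcs-∷ {D = D} {e} {L}) ac))

arc-deleteVertices : ∀ (D : Digraph n) S →
                     T (arc (deleteVertices D S) x y) ⇔ (T (arc D x y) × x ∉ S × y ∉ S)
arc-deleteVertices D S = mk⇔
  (λ t → let (d , r) = to T-∧ t; (x∉ , y∉) = to T-∧ r in d , to T-not-mem⇔∉ x∉ , to T-not-mem⇔∉ y∉)
  (λ (d , x∉ , y∉) → from T-∧ (d , from T-∧ (from T-not-mem⇔∉ x∉ , from T-not-mem⇔∉ y∉)))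

deleteVertices-⊆ : ∀ {S} → deleteVertices D S ⊆ᴰ D
deleteVertices-⊆ = proj₁ ∘ to T-∧

deleteVertices-empty : ∀ {S} → (∀ {x} → x ∉ S) → D ⊆ᴰ deleteVertices D S
deleteVertices-empty {D = D} {S} empty t = from (arc-deleteVertices D S) (t , empty , empty)

deleteVertices-twice : ∀ {R P Q} → (∀ {x} → x ∈ R → x ∈ P ⊎ x ∈ Q) →
                       deleteVertices (deleteVertices D P) Q ⊆ᴰ deleteVertices D R
deleteVertices-twice {D = D} {R} {P} {Q} cover t =
  let (t′ , x∉Q , y∉Q) = to (arc-deleteVertices (deleteVertices D P) Q) t
      (d , x∉P , y∉P) = to (arc-deleteVertices D P) t′
  in from (arc-deleteVertices D R) (d , avoid x∉P x∉Q , avoid y∉P y∉Q)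
  where
  avoid : x ∉ P → x ∉ Q → x ∉ R
  avoid x∉P x∉Q = [ x∉P , x∉Q ]′ ∘ cover

deleteVertex-off : ∀ (D : Digraph n) → ¬ x ≡ v → ¬ y ≡ v → arc (deleteVertices D ⁅ v ⁆) x y ≡ arc D x y
deleteVertex-off {x = x} {v = v} {y = y} D x≢v y≢v =
  trans (cong₂ (λ s t → arc D x y ∧ not s ∧ not t)
               (mem-∉ (x≢y⇒x∉⁅y⁆ x≢v)) (mem-∉ (x≢y⇒x∉⁅y⁆ y≢v)))
        (∧-identityʳ (arc D x y))

InvAtMost-restoreVertex : IsOriented D → InvAtMost (deleteVertices D ⁅ v ⁆) k → InvAtMost D (2 + k)
InvAtMost-restoreVertex {D = D} {v = v} oD (F , acG , |F|≤k) =
  InvAtMost-++ F (sinkFamily Dᶠ v) |F|≤k (acyclic-+sink acG (sinkFamily-sink Dᶠ v oDᶠ) K⊆G+v)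
  where
  Dᶠ = invertAll D F
  oDᶠ = invertAll-oriented F oD
  D′ = deleteVertices D ⁅ v ⁆
  away-from-v : ¬ x ≡ v → ¬ y ≡ v → arc (invertAll Dᶠ (sinkFamily Dᶠ v)) x y ≡ arc (invertAll D′ F) x y
  away-from-v x≢v y≢v =
    trans (sinkFamily-away Dᶠ v x≢v y≢v)
          (invertAll-cong F D D′ (sym (deleteVertex-off D x≢v y≢v)) (sym (deleteVertex-off D y≢v x≢v)))

  K⊆G+v : ∀ {x y} → T (arc (invertAll Dᶠ (sinkFamily Dᶠ v)) x y) →
          T (arc (invertAll D′ F) x y) ⊎ y ≡ v
  K⊆G+v {x} {y} t with x ≟ v | y ≟ v
  ... | yes refl | _ = ⊥-elim (sinkFamily-sink Dᶠ v oDᶠ t)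
  ... | no _ | yes y≡v = inj₂ y≡v
  ... | no x≢v | no y≢v = inj₁ (subst T (away-from-v x≢v y≢v) t)

InvAtMost-deleteVertices : ∀ S → Acc _⊂_ S → IsOriented D →
                           Acyclic (deleteVertices D S) → InvAtMost D (2 * ∣ S ∣)
InvAtMost-deleteVertices {D = D} S (acc smaller) oD ac with nonempty? S
... | no empty =
  acyclic⇒InvAtMost (acyclic-mono (deleteVertices-empty {D = D} (λ x∈S → empty (_ , x∈S))) ac)
... | yes (v , v∈S) =
  InvAtMost-mono bound
    (InvAtMost-restoreVertex {v = v} oD
      (InvAtMost-deleteVertices (S - v) (smaller S-v⊂S)
        (oriented-mono (deleteVertices-⊆ {D = D} {⁅ v ⁆}) oD)
        (acyclic-mono (deleteVertices-twice {D = D} cover) ac)))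
  where
  S-v⊂S : S - v ⊂ S
  S-v⊂S = p∩q≢∅⇒p─q⊂p S ⁅ v ⁆ (v , x∈p∩q⁺ (v∈S , x∈⁅x⁆ v))
  cover : x ∈ S → x ∈ ⁅ v ⁆ ⊎ x ∈ S - v
  cover {x} x∈S with x ≟ v
  ... | yes refl = inj₁ (x∈⁅x⁆ v)
  ... | no x≢v = inj₂ (x∈p∧x≢y⇒x∈p-y x∈S x≢v)
  bound : 2 + 2 * ∣ S - v ∣ ≤ 2 * ∣ S ∣
  bound = ≤-trans (≤-reflexive (sym (*-suc 2 ∣ S - v ∣))) (*-monoʳ-≤ 2 (p⊂q⇒∣p∣<∣q∣ S-v⊂S))

theorem1p1 : ∀ (n : ℕ) (D : Digraph n) → IsOriented D →
    (∀ (L : List (Fin n × Fin n)) → Acyclic (deleteArcs D L) → InvAtMost D (length L))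
    × (∀ (S : Subset n) → Acyclic (deleteVertices D S) → InvAtMost D (2 * ∣ S ∣))
theorem1p1 n D oD =
  (λ L → InvAtMost-deleteArcs L oD) ,
  (λ S → InvAtMost-deleteVertices S (⊂-wellFounded S) oD)
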